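{- Let $\mathbb M$ be a depth-1 graded monad on $\mathbf{Set}$ and let $X,Y$ be sets and $k\in\omega$. Then for every map $f\colon X\to M_kY$ we have $\overline M_1(f^*_0)=f^*_1$, where $f^*_0\colon(M_0X,\mu^{0,0}_X)\to(M_kY,\mu^{0,k}_Y)$ and $f^*_1\colon M_1X\to M_{k+1}Y$.
   Context: A graded monad $\mathbb M$ on $\mathbf{Set}$: functors $M_n$ ($n\in\omega$), $\eta\colon\mathrm{Id}\to M_0$, $\mu^{n,k}\colon M_nM_k\to M_{n+k}$ satisfying $\mu^{n,0}\cdot M_n\eta=\mathrm{id}=\mu^{0,n}\cdot\eta M_n$ and $\mu^{n+k,m}\cdot\mu^{n,k}M_m=\mu^{n,k+m}\cdot M_n\mu^{k,m}$. Graded Kleisli star: for $f\colon X\to M_kY$, $f^*_n=\mu^{n,k}_Y\cdot M_nf\colon M_nX\to M_{n+k}Y$. $\mathbb M$ is depth-1 if it is induced (uniform-depth terms modulo derivable equality) by a graded equational theory all of whose operations and equations have depth at most 1. $\mathrm{Alg}_0(\mathbb M)$ is the Eilenberg–Moore category of $(M_0,\eta,\mu^{0,0})$; $M_nX$ carries structure $\mu^{0,n}_X$. For an $M_0$-algebra $(A,a)$, $\overline M_1(A,a)$ is the coequalizer in $\mathrm{Alg}_0(\mathbb M)$ of $\mu^{1,0}_A,M_1a\colon(M_1M_0A,\mu^{0,1}_{M_0A})\to(M_1A,\mu^{0,1}_A)$, and for a homomorphism $h$, $\overline M_1h$ is the homomorphism induced by $M_1h$; for depth-1 $\mathbb M$,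 $\overline M_1(M_nX,\mu^{0,n}_X)=(M_{n+1}X,\mu^{0,n+1}_X)$ with coequalizing map $\mu^{1,n}_X$. -}

module Defs where

open import Data.Nat using (ℕ; zero; suc; _+_)
open import Data.Nat.Properties using (+-identityʳ; +-assoc)
open import Function using (_∘_; id)
open import Relation.Binary.PropositionalEquality
  using (_≡_; refl; sym; trans; cong; subst; module ≡-Reasoning)

-- A graded monad on Set (functors given by their action on maps;
-- equalities of maps are stated pointwise, as Agda has no funext).
record GradedMonad : Set₁ where
  field
    M      : ℕ → Set → Set
    map    : ∀ n {A B : Set} → (A → B) → M n A → M n B
    map-cong : ∀ n {A B : Set} {f g : A → B} → (∀ a → f a ≡ g a) →
               ∀ x → map n f x ≡ map n g x
    map-id : ∀ n {A : Set} (x : M n A) → map n id x ≡ x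
    map-∘  : ∀ n {A B C : Set} (g : B → C) (f : A → B) (x : M n A) →
             map n (g ∘ f) x ≡ map n g (map n f x)
    η      : ∀ {X : Set} → X → M 0 X
    μ      : ∀ n k {X : Set} → M n (M k X) → M (n + k) X
    η-nat  : ∀ {A B : Set} (f : A → B) (a : A) → map 0 f (η a) ≡ η (f a)
    μ-nat  : ∀ n k {A B : Set} (f : A → B) (x : M n (M k A)) →
             map (n + k) f (μ n k x) ≡ μ n k (map n (map k f) x)
    unitʳ  : ∀ n {X : Set} (x : M n X) →
             subst (λ j → M j X) (+-identityʳ n) (μ n 0 (map n η x)) ≡ x
    unitˡ  : ∀ n {X : Set} (x : M n X) → μ 0 n (η x) ≡ x
    assoc  : ∀ n k m {X : Set} (x : M n (M k (M m X))) →
             subst (λ j → M j X) (+-assoc n k m) (μ (n + k) m (μ n k x))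
               ≡ μ n (k + m) (map n (μ k m) x)

module _ (𝕄 : GradedMonad) where
  open GradedMonad 𝕄

  kstar : ∀ n {k} {X Y : Set} → (X → M k Y) → M n X → M (n + k) Y
  kstar n {k} f = μ n k ∘ map n f

  record Alg0 : Set₁ where
    field
      Carrier : Set
      act     : M 0 Carrier → Carrier
      act-η   : ∀ x → act (η x) ≡ x
      act-μ   : ∀ x → act (map 0 act x) ≡ act (μ 0 0 x)
  open Alg0 public

  IsHom : (A B : Alg0) → (Carrier A → Carrier B) → Set
  IsHom A B h = ∀ x → h (act A x) ≡ act B (map 0 h x)

  FreeAlg : ℕ → Set → Alg0
  FreeAlg n X = record
    { Carrier = M n X
    ; act     = μ 0 n
    ; act-η   = unitˡ n
    ; act-μ   = λ x → sym (assoc 0 0 n x)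
    }

  M1Alg : Alg0 → Alg0
  M1Alg A = FreeAlg 1 (Carrier A)

  M1M0Alg : Alg0 → Alg0
  M1M0Alg A = FreeAlg 1 (M 0 (Carrier A))

  record IsCoequalizer (A B C : Alg0)
           (f g : Carrier A → Carrier B) (c : Carrier B → Carrier C) : Set₁ where
    field
      c-hom   : IsHom B C c
      c-coeq  : ∀ x → c (f x) ≡ c (g x)
      factor  : (D : Alg0) (h : Carrier B → Carrier D) → IsHom B D h →
                (∀ x → h (f x) ≡ h (g x)) → Carrier C → Carrier D
      factor-hom : ∀ D h hh hq → IsHom C D (factor D h hh hq)
      factor-β   : ∀ D h hh hq x → factor D h hh hq (c x) ≡ h x
      factor-unique : ∀ D h hh hq (u : Carrier C → Carrier D) → IsHom C D u →
                      (∀ x → u (c x) ≡ h x) → ∀ y → u y ≡ factor D h hh hq y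

  IsDepth1 : Set₁
  IsDepth1 = ∀ n (X : Set) →
    IsCoequalizer (M1M0Alg (FreeAlg n X)) (M1Alg (FreeAlg n X)) (FreeAlg (suc n) X)
                  (μ 1 0) (map 1 (μ 0 n)) (μ 1 n)

  M̄1Coeq : (A C : Alg0) → (M 1 (Carrier A) → Carrier C) → Set₁
  M̄1Coeq A C c = IsCoequalizer (M1M0Alg A) (M1Alg A) C (μ 1 0) (map 1 (act A)) c

  M̄1-hom : (A B CA CB : Alg0) {cA : M 1 (Carrier A) → Carrier CA}
           {cB : M 1 (Carrier B) → Carrier CB} →
           M̄1Coeq A CA cA → M̄1Coeq B CB cB →
           (h : Carrier A → Carrier B) → IsHom A B h → Carrier CA → Carrier CB
  M̄1-hom A B CA CB {cA} {cB} qA qB h hh =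
    IsCoequalizer.factor qA CB (cB ∘ map 1 h) hom coeq
    where
    open ≡-Reasoning
    hom : IsHom (M1Alg A) CB (cB ∘ map 1 h)
    hom x = begin
      cB (map 1 h (μ 0 1 x))            ≡⟨ cong cB (μ-nat 0 1 h x) ⟩
      cB (μ 0 1 (map 0 (map 1 h) x))    ≡⟨ IsCoequalizer.c-hom qB _ ⟩
      act CB (map 0 cB (map 0 (map 1 h) x)) ≡⟨ cong (act CB) (sym (map-∘ 0 cB (map 1 h) x)) ⟩
      act CB (map 0 (cB ∘ map 1 h) x)   ∎
    coeq : ∀ x → cB (map 1 h (μ 1 0 x)) ≡ cB (map 1 h (map 1 (act A) x))
    coeq x = begin
      cB (map 1 h (μ 1 0 x))                  ≡⟨ cong cB (μ-nat 1 0 h x) ⟩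
      cB (μ 1 0 (map 1 (map 0 h) x))          ≡⟨ IsCoequalizer.c-coeq qB _ ⟩
      cB (map 1 (act B) (map 1 (map 0 h) x))  ≡⟨ cong cB (sym (map-∘ 1 (act B) (map 0 h) x)) ⟩
      cB (map 1 (act B ∘ map 0 h) x)          ≡⟨ cong cB (map-cong 1 (λ a → sym (hh a)) x) ⟩
      cB (map 1 (h ∘ act A) x)                ≡⟨ cong cB (map-∘ 1 h (act A) x) ⟩
      cB (map 1 h (map 1 (act A) x))          ∎

  kstar0-hom : ∀ {k} {X Y : Set} (f : X → M k Y) →
               IsHom (FreeAlg 0 X) (FreeAlg k Y) (kstar 0 f)
  kstar0-hom {k} f x = begin
    μ 0 k (map 0 f (μ 0 0 x))              ≡⟨ cong (μ 0 k) (μ-nat 0 0 f x) ⟩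
    μ 0 k (μ 0 0 (map 0 (map 0 f) x))      ≡⟨ assoc 0 0 k _ ⟩
    μ 0 k (map 0 (μ 0 k) (map 0 (map 0 f) x)) ≡⟨ cong (μ 0 k) (sym (map-∘ 0 (μ 0 k) (map 0 f) x)) ⟩
    μ 0 k (map 0 (μ 0 k ∘ map 0 f) x)      ∎
    where open ≡-Reasoning

{-# OPTIONS --safe #-}
-- M̄₁(f*₀) is the unique homomorphism u out of the coequalizer M̄₁(M₀X) = M₁X with
-- u ∘ μ^{1,0} = μ^{1,k} ∘ M₁ f*₀. The Kleisli extension f*₁ is a homomorphism of free
-- algebras, and associativity of μ gives f*₁ ∘ μ^{1,0} = (f*₀)*₁ = μ^{1,k} ∘ M₁ f*₀,
-- so f*₁ = M̄₁(f*₀).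
module Submission where

open import Defs
open import Data.Nat using (ℕ; suc; _+_)
open import Function using (_∘_)
open import Relation.Binary.PropositionalEquality using (_≡_; sym; cong; module ≡-Reasoning)

module _ (𝕄 : GradedMonad) where
  open GradedMonad 𝕄
  open ≡-Reasoning

  M̄1-hom-unique : (A B CA CB : Alg0 𝕄)
                  {cA : M 1 (Carrier A) → Carrier CA}
                  {cB : M 1 (Carrier B) → Carrier CB}
                  (qA : M̄1Coeq 𝕄 A CA cA) (qB : M̄1Coeq 𝕄 B CB cB)
                  (h : Carrier A → Carrier B) (hh : IsHom 𝕄 A B h)
                  (u : Carrier CA → Carrier CB) → IsHom 𝕄 CA CB u →
                  (∀ z → u (cA z) ≡ cB (map 1 h z)) →
                  ∀ y → M̄1-hom 𝕄 A B CA CB qA qB h hh y ≡ u y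
  M̄1-hom-unique A B CA CB qA qB h hh u u-hom u-β y =
    sym (IsCoequalizer.factor-unique qA _ _ _ _ u u-hom u-β y)

  -- +-assoc 0 n k reduces to refl, so the associativity law needs no transport here.
  kstar-hom : ∀ n {k} {X Y : Set} (f : X → M k Y) →
              IsHom 𝕄 (FreeAlg 𝕄 n X) (FreeAlg 𝕄 (n + k) Y) (kstar 𝕄 n f)
  kstar-hom n {k} f z = begin
    μ n k (map n f (μ 0 n z))                          ≡⟨ cong (μ n k) (μ-nat 0 n f z) ⟩
    μ n k (μ 0 n (map 0 (map n f) z))                  ≡⟨ assoc 0 n k _ ⟩
    μ 0 (n + k) (map 0 (μ n k) (map 0 (map n f) z))    ≡˘⟨ cong (μ 0 (n + k)) (map-∘ 0 (μ n k) (map n f) z) ⟩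
    μ 0 (n + k) (map 0 (μ n k ∘ map n f) z)            ∎

  -- Likewise +-assoc 1 m k reduces to refl.
  kstar-μ1 : ∀ m {k} {X Y : Set} (f : X → M k Y) (z : M 1 (M m X)) →
             kstar 𝕄 (suc m) f (μ 1 m z) ≡ kstar 𝕄 1 (kstar 𝕄 m f) z
  kstar-μ1 m {k} f z = begin
    μ (suc m) k (map (suc m) f (μ 1 m z))      ≡⟨ cong (μ (suc m) k) (μ-nat 1 m f z) ⟩
    μ (suc m) k (μ 1 m (map 1 (map m f) z))    ≡⟨ assoc 1 m k _ ⟩
    μ 1 (m + k) (map 1 (μ m k) (map 1 (map m f) z)) ≡˘⟨ cong (μ 1 (m + k)) (map-∘ 1 (μ m k) (map m f) z) ⟩
    μ 1 (m + k) (map 1 (μ m k ∘ map m f) z)    ∎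

lemmaA1 : (𝕄 : GradedMonad) (d : IsDepth1 𝕄) (X Y : Set) (k : ℕ)
          (f : X → GradedMonad.M 𝕄 k Y) →
          ∀ x → M̄1-hom 𝕄 (FreeAlg 𝕄 0 X) (FreeAlg 𝕄 k Y)
                         (FreeAlg 𝕄 1 X) (FreeAlg 𝕄 (suc k) Y)
                         (d 0 X) (d k Y) (kstar 𝕄 0 f) (kstar0-hom 𝕄 f) x
                  ≡ kstar 𝕄 1 f x
lemmaA1 𝕄 d X Y k f =
  M̄1-hom-unique 𝕄 (FreeAlg 𝕄 0 X) (FreeAlg 𝕄 k Y) (FreeAlg 𝕄 1 X) (FreeAlg 𝕄 (suc k) Y)
    (d 0 X) (d k Y) (kstar 𝕄 0 f) (kstar0-hom 𝕄 f)
    (kstar 𝕄 1 f) (kstar-hom 𝕄 1 f) (kstar-μ1 𝕄 0 f)
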